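{- Let $(T,\mu,\eta)$ be an ordered saturation monad on $\mathsf{C}$, let $S:\mathsf{C}\to\mathsf{C}$ be a functor lifting to $\overline{S}:\mathcal{K}l(T)\to\mathcal{K}l(T)$, and let $(\overline{S},m,e)$ be a monad on $\mathcal{K}l(T)$. Assume: $\mathcal{K}l(T)$ is $\omega$-cpo enriched; every hom-set of $\mathcal{K}l(T)$ has finite joins; $\overline{S}$ is locally continuous, i.e. $\overline{S}\bigvee_i f_i=\bigvee_i\overline{S}f_i$ for every chain $f_1\le f_2\le\cdots$; and $1_{\overline{S}X}\vee m_X\cdot\overline{S}\alpha=m_X\cdot\overline{S}(e_X\vee\alpha)$ for every $\alpha:X\rightsquigarrow\overline{S}X$. Then the monad $TS$ is an ordered saturation monad.
   Context: Kleisli category $\mathcal{K}l(T)$: morphisms $X\rightsquigarrow Y$ are morphisms $X\to TY$, composition $g\cdot f=\mu_Z\circ Tg\circ f$, identity $1_X=\eta_X$; $f^\sharp=\eta_Y\circ f$. $\omega$-cpo enriched: hom-sets are posets with composition monotone, every ascending chain has a supremum, and composition preserves such suprema. $S$ lifts to $\overline{S}$ if $\overline{S}X=SX$ and $\overline{S}(f^\sharp)=(Sf)^\sharp$. The monad structure on $TS$ comes from composing the adjunctions $\mathsf{C}\rightleftarrows\mathcal{K}l(T)\rightleftarrows\mathcal{K}l(\overline{S})$: its Kleisli category has $Hom(X,Y)=Hom_{\mathcal{K}l(T)}(X,SY)$, composition $g\bullet f=m_Z\cdot\overline{S}g\cdot f$, identities $e_X$, induced morphisms $e_Y\cdot f^\sharp$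 for $f$ in $\mathsf{C}$, and the order of $\mathcal{K}l(T)$. Ordered saturation monad (for monad $M$ with Kleisli composition $\cdot$, identities $1$, induced morphisms $f^\sharp$): $\mathcal{K}l(M)$ order enriched and for each $\alpha:X\rightsquigarrow X$ there is $\alpha^*$ with (1) $1\le\alpha^*$; (2) $\alpha\le\alpha^*$; (3) $\alpha^*\cdot\alpha^*\le\alpha^*$; (4) $\alpha^*\le\beta$ whenever $1\le\beta$, $\alpha\le\beta$, $\beta\cdot\beta\le\beta$; (5) for $f:X\to Y$ in $\mathsf{C}$ and $\beta:Y\rightsquigarrow Y$, $f^\sharp\cdot\alpha\le\beta\cdot f^\sharp\Rightarrow f^\sharp\cdot\alpha^*\le\beta^*\cdot f^\sharp$, and likewise with $\ge$. -}

module Defs where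

open import Level using (Level; _⊔_) renaming (suc to lsuc)
open import Data.Nat using (ℕ; suc)
open import Data.Product using (_×_)
open import Relation.Binary.Core using (Rel)
open import Relation.Binary.Structures using (IsPartialOrder)
open import Relation.Binary.PropositionalEquality
  using (_≡_; refl; sym; trans; cong; cong₂; module ≡-Reasoning)

record Category (o h : Level) : Set (lsuc (o ⊔ h)) where
  infixr 9 _∘_
  field
    Obj       : Set o
    Hom       : Obj → Obj → Set h
    id        : ∀ {X} → Hom X X
    _∘_       : ∀ {X Y Z} → Hom Y Z → Hom X Y → Hom X Z
    identityˡ : ∀ {X Y} (f : Hom X Y) → id ∘ f ≡ f
    identityʳ : ∀ {X Y} (f : Hom X Y) → f ∘ id ≡ f
    assoc     : ∀ {W X Y Z} (h : Hom Y Z) (g : Hom X Y) (f : Hom W X) →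
                (h ∘ g) ∘ f ≡ h ∘ (g ∘ f)

record Functor {o h o' h'} (C : Category o h) (D : Category o' h')
       : Set (o ⊔ h ⊔ o' ⊔ h') where
  private
    module C = Category C
    module D = Category D
  field
    F₀   : C.Obj → D.Obj
    F₁   : ∀ {X Y} → C.Hom X Y → D.Hom (F₀ X) (F₀ Y)
    F-id : ∀ {X} → F₁ (C.id {X}) ≡ D.id
    F-∘  : ∀ {X Y Z} (g : C.Hom Y Z) (f : C.Hom X Y) →
           F₁ (g C.∘ f) ≡ F₁ g D.∘ F₁ f

record IsMonad {o h} (C : Category o h) (F : Functor C C) : Set (o ⊔ h) where
  open Category C
  open Functor F
  field
    η      : ∀ X → Hom X (F₀ X)
    μ      : ∀ X → Hom (F₀ (F₀ X)) (F₀ X)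
    η-nat  : ∀ {X Y} (f : Hom X Y) → F₁ f ∘ η X ≡ η Y ∘ f
    μ-nat  : ∀ {X Y} (f : Hom X Y) → μ Y ∘ F₁ (F₁ f) ≡ F₁ f ∘ μ X
    μ-assoc : ∀ X → μ X ∘ F₁ (μ X) ≡ μ X ∘ μ (F₀ X)
    μ-η    : ∀ X → μ X ∘ η (F₀ X) ≡ id
    μ-Fη   : ∀ X → μ X ∘ F₁ (η X) ≡ id

module KleisliOf {o h} (C : Category o h) (F : Functor C C) (M : IsMonad C F) where
  open Category C
  open Functor F
  open IsMonad M
  open ≡-Reasoning

  KHom : Obj → Obj → Set h
  KHom X Y = Hom X (F₀ Y)

  infixr 9 _·_
  _·_ : ∀ {X Y Z} → KHom Y Z → KHom X Y → KHom X Z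
  _·_ {Z = Z} g f = μ Z ∘ (F₁ g ∘ f)

  kid : ∀ {X} → KHom X X
  kid {X} = η X

  _♯ : ∀ {X Y} → Hom X Y → KHom X Y
  _♯ {Y = Y} f = η Y ∘ f

  private
    kidˡ : ∀ {X Y} (f : KHom X Y) → kid · f ≡ f
    kidˡ {Y = Y} f = begin
      μ Y ∘ (F₁ (η Y) ∘ f) ≡⟨ sym (assoc _ _ _) ⟩
      (μ Y ∘ F₁ (η Y)) ∘ f ≡⟨ cong (_∘ f) (μ-Fη Y) ⟩
      id ∘ f               ≡⟨ identityˡ f ⟩
      f                    ∎

    kidʳ : ∀ {X Y} (f : KHom X Y) → f · kid ≡ f
    kidʳ {X} {Y} f = begin
      μ Y ∘ (F₁ f ∘ η X)        ≡⟨ cong (μ Y ∘_) (η-nat f) ⟩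
      μ Y ∘ (η (F₀ Y) ∘ f)      ≡⟨ sym (assoc _ _ _) ⟩
      (μ Y ∘ η (F₀ Y)) ∘ f      ≡⟨ cong (_∘ f) (μ-η Y) ⟩
      id ∘ f                    ≡⟨ identityˡ f ⟩
      f                         ∎

    kassoc : ∀ {W X Y Z} (k : KHom Y Z) (g : KHom X Y) (f : KHom W X) →
             (k · g) · f ≡ k · (g · f)
    kassoc {W} {X} {Y} {Z} k g f = begin
      μ Z ∘ (F₁ (μ Z ∘ (F₁ k ∘ g)) ∘ f)
        ≡⟨ cong (λ u → μ Z ∘ (u ∘ f))
             (trans (F-∘ _ _) (cong (F₁ (μ Z) ∘_) (F-∘ _ _))) ⟩
      μ Z ∘ ((F₁ (μ Z) ∘ (F₁ (F₁ k) ∘ F₁ g)) ∘ f)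
        ≡⟨ cong (μ Z ∘_) (assoc _ _ _) ⟩
      μ Z ∘ (F₁ (μ Z) ∘ ((F₁ (F₁ k) ∘ F₁ g) ∘ f))
        ≡⟨ sym (assoc _ _ _) ⟩
      (μ Z ∘ F₁ (μ Z)) ∘ ((F₁ (F₁ k) ∘ F₁ g) ∘ f)
        ≡⟨ cong (_∘ ((F₁ (F₁ k) ∘ F₁ g) ∘ f)) (μ-assoc Z) ⟩
      (μ Z ∘ μ (F₀ Z)) ∘ ((F₁ (F₁ k) ∘ F₁ g) ∘ f)
        ≡⟨ assoc _ _ _ ⟩
      μ Z ∘ (μ (F₀ Z) ∘ ((F₁ (F₁ k) ∘ F₁ g) ∘ f))
        ≡⟨ cong (λ u → μ Z ∘ (μ (F₀ Z) ∘ u)) (assoc _ _ _) ⟩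
      μ Z ∘ (μ (F₀ Z) ∘ (F₁ (F₁ k) ∘ (F₁ g ∘ f)))
        ≡⟨ cong (μ Z ∘_) (sym (assoc _ _ _)) ⟩
      μ Z ∘ ((μ (F₀ Z) ∘ F₁ (F₁ k)) ∘ (F₁ g ∘ f))
        ≡⟨ cong (λ u → μ Z ∘ (u ∘ (F₁ g ∘ f))) (μ-nat k) ⟩
      μ Z ∘ ((F₁ k ∘ μ Y) ∘ (F₁ g ∘ f))
        ≡⟨ cong (μ Z ∘_) (assoc _ _ _) ⟩
      μ Z ∘ (F₁ k ∘ (μ Y ∘ (F₁ g ∘ f)))
        ∎

  Kl : Category o h
  Kl = record
    { Obj = Obj ; Hom = KHom ; id = kid ; _∘_ = _·_
    ; identityˡ = kidˡ ; identityʳ = kidʳ ; assoc = kassoc }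

record KleisliData {o h} (C : Category o h) (h' : Level) : Set (o ⊔ h ⊔ lsuc h') where
  open Category C
  infixr 9 _·_
  field
    KHom : Obj → Obj → Set h'
    _·_  : ∀ {X Y Z} → KHom Y Z → KHom X Y → KHom X Z
    kid  : ∀ {X} → KHom X X
    _♯   : ∀ {X Y} → Hom X Y → KHom X Y

record IsOrderEnriched {o h h' ℓ} {C : Category o h} (K : KleisliData C h')
       (_≤_ : ∀ {X Y} → Rel (KleisliData.KHom K X Y) ℓ) : Set (o ⊔ h' ⊔ ℓ) where
  open KleisliData K
  field
    isPartialOrder : ∀ X Y → IsPartialOrder _≡_ (_≤_ {X} {Y})
    ·-mono : ∀ {X Y Z} {g g' : KHom Y Z} {f f' : KHom X Y} →
             g ≤ g' → f ≤ f' → (g · f) ≤ (g' · f')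

record IsOrderedSaturation {o h h' ℓ} {C : Category o h} (K : KleisliData C h')
       (_≤_ : ∀ {X Y} → Rel (KleisliData.KHom K X Y) ℓ) : Set (o ⊔ h ⊔ h' ⊔ ℓ) where
  open Category C using (Hom)
  open KleisliData K
  field
    orderEnriched : IsOrderEnriched K _≤_
    _*     : ∀ {X} → KHom X X → KHom X X
    sat-1  : ∀ {X} (α : KHom X X) → kid ≤ (α *)
    sat-2  : ∀ {X} (α : KHom X X) → α ≤ (α *)
    sat-3  : ∀ {X} (α : KHom X X) → ((α *) · (α *)) ≤ (α *)
    sat-4  : ∀ {X} (α β : KHom X X) →
             kid ≤ β → α ≤ β → (β · β) ≤ β → (α *) ≤ β
    sat-5≤ : ∀ {X Y} (f : Hom X Y) (α : KHom X X) (β : KHom Y Y) →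
             ((f ♯) · α) ≤ (β · (f ♯)) → ((f ♯) · (α *)) ≤ ((β *) · (f ♯))
    sat-5≥ : ∀ {X Y} (f : Hom X Y) (α : KHom X X) (β : KHom Y Y) →
             (β · (f ♯)) ≤ ((f ♯) · α) → ((β *) · (f ♯)) ≤ ((f ♯) · (α *))

module _ {o h ℓ} (D : Category o h)
         (_≤_ : ∀ {X Y} → Rel (Category.Hom D X Y) ℓ) where
  open Category D

  IsChain : ∀ {X Y} → (ℕ → Hom X Y) → Set ℓ
  IsChain c = ∀ n → c n ≤ c (suc n)

  IsSup : ∀ {X Y} → Hom X Y → (ℕ → Hom X Y) → Set (h ⊔ ℓ)
  IsSup {X} {Y} s c = (∀ n → c n ≤ s) × (∀ (u : Hom X Y) → (∀ n → c n ≤ u) → s ≤ u)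

  record IsωCpoEnriched : Set (o ⊔ h ⊔ ℓ) where
    field
      ⋁      : ∀ {X Y} (c : ℕ → Hom X Y) → IsChain c → Hom X Y
      ⋁-sup  : ∀ {X Y} (c : ℕ → Hom X Y) (p : IsChain c) → IsSup (⋁ c p) c
      ∘-⋁ˡ   : ∀ {X Y Z} (g : Hom Y Z) (c : ℕ → Hom X Y) (p : IsChain c) →
               IsSup (g ∘ ⋁ c p) (λ n → g ∘ c n)
      ∘-⋁ʳ   : ∀ {X Y Z} (c : ℕ → Hom Y Z) (p : IsChain c) (f : Hom X Y) →
               IsSup (⋁ c p ∘ f) (λ n → c n ∘ f)

  record HasFiniteJoins : Set (o ⊔ h ⊔ ℓ) where
    infixr 6 _∨_
    field
      ⊥       : ∀ {X Y} → Hom X Y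
      ⊥-least : ∀ {X Y} (f : Hom X Y) → ⊥ ≤ f
      _∨_     : ∀ {X Y} → Hom X Y → Hom X Y → Hom X Y
      ∨-ub₁   : ∀ {X Y} (f g : Hom X Y) → f ≤ (f ∨ g)
      ∨-ub₂   : ∀ {X Y} (f g : Hom X Y) → g ≤ (f ∨ g)
      ∨-least : ∀ {X Y} (f g u : Hom X Y) → f ≤ u → g ≤ u → (f ∨ g) ≤ u

module _ {o h} (C : Category o h) (T : Functor C C) (MT : IsMonad C T) where
  open KleisliOf C T MT

  KlDataT : KleisliData C h
  KlDataT = record { KHom = KHom ; _·_ = _·_ ; kid = kid ; _♯ = _♯ }

  record Lifting (S : Functor C C) : Set (o ⊔ h) where
    open Functor S renaming (F₀ to S₀; F₁ to S₁)
    field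
      S̄₁     : ∀ {X Y} → KHom X Y → KHom (S₀ X) (S₀ Y)
      S̄-id   : ∀ {X} → S̄₁ (kid {X}) ≡ kid
      S̄-∘    : ∀ {X Y Z} (g : KHom Y Z) (f : KHom X Y) → S̄₁ (g · f) ≡ S̄₁ g · S̄₁ f
      S̄-♯    : ∀ {X Y} (f : Category.Hom C X Y) → S̄₁ (f ♯) ≡ (S₁ f) ♯

  liftedFunctor : ∀ {S : Functor C C} → Lifting S → Functor Kl Kl
  liftedFunctor {S} L = record
    { F₀ = Functor.F₀ S ; F₁ = Lifting.S̄₁ L
    ; F-id = Lifting.S̄-id L ; F-∘ = Lifting.S̄-∘ L }

  -- Kleisli data of the composite monad TS, obtained from composing the
  -- adjunctions C ⇄ Kl(T) ⇄ Kl(S̄):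
  --   Hom(X,Y) = Kl(T)(X, SY),  g • f = m_Z · S̄g · f,  identities e_X,
  --   induced morphisms e_Y · f♯.
  KlDataTS : ∀ {S : Functor C C} (L : Lifting S) →
             IsMonad Kl (liftedFunctor L) → KleisliData C h
  KlDataTS {S} L MS = record
    { KHom = λ X Y → KHom X (Functor.F₀ S Y)
    ; _·_  = λ {X} {Y} {Z} g f → IsMonad.μ MS Z · (Lifting.S̄₁ L g · f)
    ; kid  = λ {X} → IsMonad.η MS X
    ; _♯   = λ {X} {Y} f → IsMonad.η MS Y · (f ♯)
    }

-- Write ᾱ = ext α = m · S̄α for the Kleisli extension of α : X ⇝ S̄X, so that composition
-- in Kl(TS) is β • α = β̄ · α.  The saturation of α in Kl(TS) is ᾱ* · e.  Everything rests
-- on the equation  ext (ᾱ* · e) = ᾱ*:  in an ω-cpo enriched category with joins, ᾱ* is the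
-- supremum of the powers of 1 ∨ ᾱ, the join hypothesis says 1 ∨ ᾱ is itself the extension
-- of e ∨ α, every power of an extension γ̄ is the extension of γ̄ⁿ · e, and extension
-- commutes with suprema of chains by local continuity of S̄.  With this equation, axioms
-- (1)–(5) for TS are those of T applied to extensions, restricted along e.
module Submission where

open import Defs
open import Level using (Level; _⊔_)
open import Data.Nat using (ℕ; zero; suc; _+_)
open import Data.Product using (_,_; proj₁; proj₂)
open import Relation.Binary.Core using (Rel)
open import Relation.Binary.Bundles using (Poset)
open import Relation.Binary.Structures using (IsPartialOrder)
open import Relation.Binary.PropositionalEquality
  using (_≡_; refl; sym; trans; cong; subst; module ≡-Reasoning)
import Relation.Binary.Reasoning.PartialOrder as PartialOrderReasoning

module Powers {o h} (D : Category o h) where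
  open Category D

  infixl 30 _^_
  _^_ : ∀ {X} → Hom X X → ℕ → Hom X X
  δ ^ zero  = id
  δ ^ suc n = δ ∘ δ ^ n

  ^-+ : ∀ {X} (δ : Hom X X) m n → δ ^ m ∘ δ ^ n ≡ δ ^ (m + n)
  ^-+ δ zero    n = identityˡ (δ ^ n)
  ^-+ δ (suc m) n = trans (assoc δ (δ ^ m) (δ ^ n)) (cong (δ ∘_) (^-+ δ m n))

module MonadExtension {o h} {D : Category o h} {F : Functor D D} (M : IsMonad D F) where
  open Category D
  open Functor F
  open IsMonad M
  open Powers D
  open ≡-Reasoning

  ext : ∀ {X Y} → Hom X (F₀ Y) → Hom (F₀ X) (F₀ Y)
  ext {Y = Y} α = μ Y ∘ F₁ α

  ext-η : ∀ {X} → ext (η X) ≡ id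
  ext-η {X} = μ-Fη X

  ext-∘-η : ∀ {X Y} (α : Hom X (F₀ Y)) → ext α ∘ η X ≡ α
  ext-∘-η {X} {Y} α = begin
    (μ Y ∘ F₁ α) ∘ η X     ≡⟨ assoc _ _ _ ⟩
    μ Y ∘ (F₁ α ∘ η X)     ≡⟨ cong (μ Y ∘_) (η-nat α) ⟩
    μ Y ∘ (η (F₀ Y) ∘ α)   ≡⟨ assoc _ _ _ ⟨
    (μ Y ∘ η (F₀ Y)) ∘ α   ≡⟨ cong (_∘ α) (μ-η Y) ⟩
    id ∘ α                 ≡⟨ identityˡ α ⟩
    α                      ∎

  ext-η-∘ : ∀ {X Y} (g : Hom X Y) → ext (η Y ∘ g) ≡ F₁ g
  ext-η-∘ {Y = Y} g = begin
    μ Y ∘ F₁ (η Y ∘ g)        ≡⟨ cong (μ Y ∘_) (F-∘ (η Y) g) ⟩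
    μ Y ∘ (F₁ (η Y) ∘ F₁ g)   ≡⟨ assoc _ _ _ ⟨
    (μ Y ∘ F₁ (η Y)) ∘ F₁ g   ≡⟨ cong (_∘ F₁ g) (μ-Fη Y) ⟩
    id ∘ F₁ g                 ≡⟨ identityˡ (F₁ g) ⟩
    F₁ g                      ∎

  ext-∘-F₁ : ∀ {X Y Z} (β : Hom Y (F₀ Z)) (g : Hom X Y) → ext β ∘ F₁ g ≡ ext (β ∘ g)
  ext-∘-F₁ {Z = Z} β g = begin
    (μ Z ∘ F₁ β) ∘ F₁ g   ≡⟨ assoc _ _ _ ⟩
    μ Z ∘ (F₁ β ∘ F₁ g)   ≡⟨ cong (μ Z ∘_) (F-∘ β g) ⟨
    μ Z ∘ F₁ (β ∘ g)      ∎

  F₁-∘-ext : ∀ {X Y Z} (g : Hom Y Z) (α : Hom X (F₀ Y)) → F₁ g ∘ ext α ≡ ext (F₁ g ∘ α)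
  F₁-∘-ext {Y = Y} {Z} g α = begin
    F₁ g ∘ (μ Y ∘ F₁ α)          ≡⟨ assoc _ _ _ ⟨
    (F₁ g ∘ μ Y) ∘ F₁ α          ≡⟨ cong (_∘ F₁ α) (μ-nat g) ⟨
    (μ Z ∘ F₁ (F₁ g)) ∘ F₁ α     ≡⟨ ext-∘-F₁ (F₁ g) α ⟩
    μ Z ∘ F₁ (F₁ g ∘ α)          ∎

  ext-∘-ext : ∀ {X Y Z} (β : Hom Y (F₀ Z)) (α : Hom X (F₀ Y)) →
              ext (ext β ∘ α) ≡ ext β ∘ ext α
  ext-∘-ext {Y = Y} {Z} β α = begin
    μ Z ∘ F₁ ((μ Z ∘ F₁ β) ∘ α)   ≡⟨ cong ext (assoc _ _ _) ⟩
    μ Z ∘ F₁ (μ Z ∘ (F₁ β ∘ α))   ≡⟨ ext-∘-F₁ (μ Z) (F₁ β ∘ α) ⟨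
    ext (μ Z) ∘ F₁ (F₁ β ∘ α)     ≡⟨ cong (_∘ F₁ (F₁ β ∘ α)) (μ-assoc Z) ⟩
    (μ Z ∘ μ (F₀ Z)) ∘ F₁ (F₁ β ∘ α)
                                  ≡⟨ assoc _ _ _ ⟩
    μ Z ∘ ext (F₁ β ∘ α)          ≡⟨ cong (μ Z ∘_) (F₁-∘-ext β α) ⟨
    μ Z ∘ (F₁ β ∘ ext α)          ≡⟨ assoc _ _ _ ⟨
    ext β ∘ ext α                 ∎

  ext-^-∘-η : ∀ {X} (γ : Hom X (F₀ X)) n → ext (ext γ ^ n ∘ η X) ≡ ext γ ^ n
  ext-^-∘-η {X} γ zero = trans (cong ext (identityˡ (η X))) ext-η
  ext-^-∘-η {X} γ (suc n) = begin
    ext ((ext γ ∘ ext γ ^ n) ∘ η X)   ≡⟨ cong ext (assoc _ _ _) ⟩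
    ext (ext γ ∘ (ext γ ^ n ∘ η X))   ≡⟨ ext-∘-ext γ (ext γ ^ n ∘ η X) ⟩
    ext γ ∘ ext (ext γ ^ n ∘ η X)     ≡⟨ cong (ext γ ∘_) (ext-^-∘-η γ n) ⟩
    ext γ ∘ ext γ ^ n                 ∎

module ωCpoEnrichedCategory {o h ℓ} (D : Category o h)
    {_≤_ : ∀ {X Y} → Rel (Category.Hom D X Y) ℓ}
    (isPartialOrder : ∀ X Y → IsPartialOrder _≡_ (_≤_ {X} {Y}))
    (∘-mono : ∀ {X Y Z} {g g' : Category.Hom D Y Z} {f f' : Category.Hom D X Y} →
              g ≤ g' → f ≤ f' → Category._∘_ D g f ≤ Category._∘_ D g' f')
    (W : IsωCpoEnriched D _≤_)
  where
  open Category D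
  open IsωCpoEnriched W
  open Powers D

  poset : Obj → Obj → Poset h h ℓ
  poset X Y = record
    { Carrier = Hom X Y ; _≈_ = _≡_ ; _≤_ = _≤_ ; isPartialOrder = isPartialOrder X Y }

  module ≤-Reasoning {X Y} = PartialOrderReasoning (poset X Y)

  module _ {X Y : Obj} where
    open IsPartialOrder (isPartialOrder X Y) public using () renaming
      (refl to ≤-refl; antisym to ≤-antisym)

  ≤-resp-≡ : ∀ {X Y} {f f' g g' : Hom X Y} → f ≡ f' → g ≡ g' → f ≤ g → f' ≤ g'
  ≤-resp-≡ refl refl f≤g = f≤g

  sup-unique : ∀ {X Y} {s s' : Hom X Y} {c : ℕ → Hom X Y} →
               IsSup D _≤_ s c → IsSup D _≤_ s' c → s ≡ s'
  sup-unique (s-ub , s-least) (s'-ub , s'-least) =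
    ≤-antisym (s-least _ s'-ub) (s'-least _ s-ub)

  sup-resp-≡ : ∀ {X Y} {s : Hom X Y} {c c' : ℕ → Hom X Y} →
               (∀ n → c n ≡ c' n) → IsSup D _≤_ s c → IsSup D _≤_ s c'
  sup-resp-≡ c≡c' (ub , least) =
      (λ n → ≤-resp-≡ (c≡c' n) refl (ub n))
    , (λ u ub' → least u (λ n → ≤-resp-≡ (sym (c≡c' n)) refl (ub' n)))

  ∘-supˡ : ∀ {X Y Z} (g : Hom Y Z) {s : Hom X Y} {c : ℕ → Hom X Y} →
           IsChain D _≤_ c → IsSup D _≤_ s c → IsSup D _≤_ (g ∘ s) (λ n → g ∘ c n)
  ∘-supˡ g {c = c} p s-sup =
    subst (λ t → IsSup D _≤_ (g ∘ t) _) (sup-unique (⋁-sup c p) s-sup) (∘-⋁ˡ g c p)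

  Continuous : ∀ {X Y X' Y'} → (Hom X Y → Hom X' Y') → Set (h ⊔ ℓ)
  Continuous F = ∀ c (p : IsChain D _≤_ c) → IsSup D _≤_ (F (⋁ c p)) (λ n → F (c n))

  continuous-sup : ∀ {X Y X' Y'} {F : Hom X Y → Hom X' Y'} → Continuous F →
                   ∀ {s c} → IsChain D _≤_ c → IsSup D _≤_ s c →
                   IsSup D _≤_ (F s) (λ n → F (c n))
  continuous-sup {F = F} F-cont {c = c} p s-sup =
    subst (λ t → IsSup D _≤_ (F t) _) (sup-unique (⋁-sup c p) s-sup) (F-cont c p)

  -- The chain f ≤ g ≤ g ≤ ⋯ has supremum g.
  continuous⇒monotone : ∀ {X Y X' Y'} {F : Hom X Y → Hom X' Y'} → Continuous F →
                        ∀ {f g} → f ≤ g → F f ≤ F g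
  continuous⇒monotone F-cont {f} {g} f≤g =
    proj₁ (continuous-sup F-cont chain (upper , λ u ub → ub 1)) 0
    where
    c : ℕ → Hom _ _
    c zero    = f
    c (suc _) = g
    chain : IsChain D _≤_ c
    chain zero    = f≤g
    chain (suc _) = ≤-refl
    upper : ∀ n → c n ≤ g
    upper zero    = f≤g
    upper (suc _) = ≤-refl

  powers-chain : ∀ {X} {δ : Hom X X} → id ≤ δ → IsChain D _≤_ (δ ^_)
  powers-chain {δ = δ} id≤δ n = ≤-resp-≡ (identityˡ (δ ^ n)) refl (∘-mono id≤δ ≤-refl)

  ⋁-powers : ∀ {X} (δ : Hom X X) → id ≤ δ → Hom X X
  ⋁-powers δ id≤δ = ⋁ (δ ^_) (powers-chain id≤δ)

  ⋁-powers-∘-≤ : ∀ {X} {δ : Hom X X} (id≤δ : id ≤ δ) →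
                 (⋁-powers δ id≤δ ∘ ⋁-powers δ id≤δ) ≤ ⋁-powers δ id≤δ
  ⋁-powers-∘-≤ {δ = δ} id≤δ =
    proj₂ (∘-⋁ˡ P (δ ^_) chain) P λ k →
    proj₂ (∘-⋁ʳ (δ ^_) chain (δ ^ k)) P λ n →
    ≤-resp-≡ (sym (^-+ δ n k)) refl (proj₁ (⋁-sup (δ ^_) chain) (n + k))
    where
    chain : IsChain D _≤_ (δ ^_)
    chain = powers-chain id≤δ
    P : Hom _ _
    P = ⋁-powers δ id≤δ

module SaturationAsSupremum {o h ℓ} (C : Category o h) (T : Functor C C) (MT : IsMonad C T)
    {_≤_ : ∀ {X Y} → Rel (KleisliOf.KHom C T MT X Y) ℓ}
    (OS : IsOrderedSaturation (KlDataT C T MT) _≤_)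
    (W : IsωCpoEnriched (KleisliOf.Kl C T MT) _≤_)
    (J : HasFiniteJoins (KleisliOf.Kl C T MT) _≤_)
  where
  open KleisliOf C T MT
  open IsOrderedSaturation OS renaming (_* to _⋆)
  open IsOrderEnriched orderEnriched
  open ωCpoEnrichedCategory Kl isPartialOrder ·-mono W
  open IsωCpoEnriched W
  open HasFiniteJoins J
  open Powers Kl

  ⋆≡⋁-powers : ∀ {X} (a : KHom X X) → a ⋆ ≡ ⋁-powers (kid ∨ a) (∨-ub₁ kid a)
  ⋆≡⋁-powers {X} a = ≤-antisym
    (sat-4 a P (upper 0) a≤P (⋁-powers-∘-≤ (∨-ub₁ kid a)))
    (proj₂ (⋁-sup (δ ^_) chain) (a ⋆) powers≤⋆)
    where
    δ : KHom X X
    δ = kid ∨ a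
    chain : IsChain Kl _≤_ (δ ^_)
    chain = powers-chain (∨-ub₁ kid a)
    P : KHom X X
    P = ⋁-powers δ (∨-ub₁ kid a)
    upper : ∀ n → δ ^ n ≤ P
    upper = proj₁ (⋁-sup (δ ^_) chain)
    a≤P : a ≤ P
    a≤P = let open ≤-Reasoning in begin
      a          ≤⟨ ∨-ub₂ kid a ⟩
      δ          ≡⟨ Category.identityʳ Kl δ ⟨
      δ · δ ^ 0  ≤⟨ upper 1 ⟩
      P          ∎
    powers≤⋆ : ∀ n → δ ^ n ≤ (a ⋆)
    powers≤⋆ zero    = sat-1 a
    powers≤⋆ (suc n) = let open ≤-Reasoning in begin
      δ · δ ^ n    ≤⟨ ·-mono (∨-least kid a (a ⋆) (sat-1 a) (sat-2 a)) (powers≤⋆ n) ⟩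
      a ⋆ · a ⋆    ≤⟨ sat-3 a ⟩
      a ⋆          ∎

module SaturationOfComposite {o h ℓ : Level} (C : Category o h) (T : Functor C C) (MT : IsMonad C T)
    (_≤_ : ∀ {X Y} → Rel (KleisliOf.KHom C T MT X Y) ℓ)
    (OS : IsOrderedSaturation (KlDataT C T MT) _≤_)
    (S : Functor C C) (L : Lifting C T MT S) (MS : IsMonad (KleisliOf.Kl C T MT) (liftedFunctor C T MT L))
    (W : IsωCpoEnriched (KleisliOf.Kl C T MT) _≤_)
    (J : HasFiniteJoins (KleisliOf.Kl C T MT) _≤_)
    (S̄-continuous : ∀ {X Y} → ωCpoEnrichedCategory.Continuous (KleisliOf.Kl C T MT)
                      (IsOrderEnriched.isPartialOrder (IsOrderedSaturation.orderEnriched OS))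
                      (IsOrderEnriched.·-mono (IsOrderedSaturation.orderEnriched OS)) W
                      (Lifting.S̄₁ L {X} {Y}))
    (join-ext : ∀ {X} (α : KleisliOf.KHom C T MT X (Functor.F₀ S X))
      → HasFiniteJoins._∨_ J (KleisliOf.kid C T MT)
          (KleisliOf._·_ C T MT (IsMonad.μ MS X) (Lifting.S̄₁ L α))
        ≡ KleisliOf._·_ C T MT (IsMonad.μ MS X)
            (Lifting.S̄₁ L (HasFiniteJoins._∨_ J (IsMonad.η MS X) α)))
  where
  open Category C using (Hom)
  open KleisliOf C T MT
  open Category Kl using (assoc; identityˡ)
  open Functor S using () renaming (F₀ to S₀; F₁ to S₁)
  open Lifting L
  open IsMonad MS using () renaming (η to e; μ to m; η-nat to e-nat)
  module Sat = IsOrderedSaturation OS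
  open Sat using (orderEnriched) renaming (_* to _⋆)
  open IsOrderEnriched orderEnriched
  open ωCpoEnrichedCategory Kl isPartialOrder ·-mono W
  open IsωCpoEnriched W
  open HasFiniteJoins J using (_∨_; ∨-ub₁)
  open MonadExtension MS
  open Powers Kl
  open SaturationAsSupremum C T MT OS W J

  S̄-mono : ∀ {X Y} {f g : KHom X Y} → f ≤ g → S̄₁ f ≤ S̄₁ g
  S̄-mono = continuous⇒monotone S̄-continuous

  ext-mono : ∀ {X Y} {α β : KHom X (S₀ Y)} → α ≤ β → ext α ≤ ext β
  ext-mono α≤β = ·-mono ≤-refl (S̄-mono α≤β)

  ext-sup : ∀ {X Y} {s : KHom X (S₀ Y)} {c} → IsChain Kl _≤_ c → IsSup Kl _≤_ s c →
            IsSup Kl _≤_ (ext s) (λ n → ext (c n))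
  ext-sup p s-sup = ∘-supˡ (m _) (λ n → S̄-mono (p n)) (continuous-sup S̄-continuous p s-sup)

  star : ∀ {X} → KHom X (S₀ X) → KHom X (S₀ X)
  star {X} α = ext α ⋆ · e X

  ext-star : ∀ {X} (α : KHom X (S₀ X)) → ext (star α) ≡ ext α ⋆
  ext-star {X} α = begin
    ext (ext α ⋆ · e X)   ≡⟨ cong (λ t → ext (t · e X)) a⋆≡P ⟩
    ext (P · e X)         ≡⟨ sup-unique ext-P·e-sup (⋁-sup (δ ^_) chain) ⟩
    P                     ≡⟨ a⋆≡P ⟨
    ext α ⋆               ∎
    where
    open ≡-Reasoning
    δ : KHom (S₀ X) (S₀ X)
    δ = kid ∨ ext α
    chain : IsChain Kl _≤_ (δ ^_)
    chain = powers-chain (∨-ub₁ kid (ext α))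
    P : KHom (S₀ X) (S₀ X)
    P = ⋁-powers δ (∨-ub₁ kid (ext α))
    a⋆≡P : ext α ⋆ ≡ P
    a⋆≡P = ⋆≡⋁-powers (ext α)
    ext-power : ∀ n → ext (δ ^ n · e X) ≡ δ ^ n
    ext-power n = subst (λ d → ext (d ^ n · e X) ≡ d ^ n) (sym (join-ext α))
                        (ext-^-∘-η (e X ∨ α) n)
    ext-P·e-sup : IsSup Kl _≤_ (ext (P · e X)) (δ ^_)
    ext-P·e-sup = sup-resp-≡ ext-power
      (ext-sup (λ n → ·-mono (chain n) ≤-refl) (∘-⋁ʳ (δ ^_) chain (e X)))

  •-ext : ∀ {X Y Z} (β : KHom Y (S₀ Z)) (α : KHom X (S₀ Y)) → m Z · (S̄₁ β · α) ≡ ext β · α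
  •-ext β α = sym (assoc _ _ _)

  e-♯ : ∀ {X Y} (f : Hom X Y) → e Y · f ♯ ≡ S₁ f ♯ · e X
  e-♯ {X} f = trans (sym (e-nat (f ♯))) (cong (_· e X) (S̄-♯ f))

  ext-e-♯ : ∀ {X Y} (f : Hom X Y) → ext (e Y · f ♯) ≡ S₁ f ♯
  ext-e-♯ f = trans (ext-η-∘ (f ♯)) (S̄-♯ f)

  ♯-•ˡ : ∀ {X Y Z} (f : Hom X Y) (α : KHom Z (S₀ X)) → m Y · (S̄₁ (e Y · f ♯) · α) ≡ S₁ f ♯ · α
  ♯-•ˡ f α = trans (•-ext _ α) (cong (_· α) (ext-e-♯ f))

  ♯-•ʳ : ∀ {X Y Z} (β : KHom Y (S₀ Z)) (f : Hom X Y) → m Z · (S̄₁ β · (e Y · f ♯)) ≡ β · f ♯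
  ♯-•ʳ {Y = Y} β f = begin
    m _ · (S̄₁ β · (e Y · f ♯))   ≡⟨ •-ext β _ ⟩
    ext β · (e Y · f ♯)          ≡⟨ assoc _ _ _ ⟨
    (ext β · e Y) · f ♯          ≡⟨ cong (_· f ♯) (ext-∘-η β) ⟩
    β · f ♯                      ∎
    where open ≡-Reasoning

  ♯-ext : ∀ {X Y Z} (f : Hom X Y) (α : KHom Z (S₀ X)) → S₁ f ♯ · ext α ≡ ext (S₁ f ♯ · α)
  ♯-ext f α = subst (λ g → g · ext α ≡ ext (g · α)) (S̄-♯ f) (F₁-∘-ext (f ♯) α)

  ext-♯ : ∀ {X Y Z} (β : KHom Y (S₀ Z)) (f : Hom X Y) → ext β · S₁ f ♯ ≡ ext (β · f ♯)
  ext-♯ β f = subst (λ g → ext β · g ≡ ext (β · f ♯)) (S̄-♯ f) (ext-∘-F₁ β (f ♯))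

  ♯-•-star : ∀ {X Y} (f : Hom X Y) (α : KHom X (S₀ X)) →
             m Y · (S̄₁ (e Y · f ♯) · star α) ≡ (S₁ f ♯ · ext α ⋆) · e X
  ♯-•-star f α = trans (♯-•ˡ f (star α)) (sym (assoc _ _ _))

  star-•-♯ : ∀ {X Y} (f : Hom X Y) (β : KHom Y (S₀ Y)) →
             m Y · (S̄₁ (star β) · (e Y · f ♯)) ≡ (ext β ⋆ · S₁ f ♯) · e X
  star-•-♯ {X} {Y} f β = begin
    m Y · (S̄₁ (star β) · (e Y · f ♯))   ≡⟨ ♯-•ʳ (star β) f ⟩
    (ext β ⋆ · e Y) · f ♯               ≡⟨ assoc _ _ _ ⟩
    ext β ⋆ · (e Y · f ♯)               ≡⟨ cong (ext β ⋆ ·_) (e-♯ f) ⟩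
    ext β ⋆ · (S₁ f ♯ · e X)            ≡⟨ assoc _ _ _ ⟨
    (ext β ⋆ · S₁ f ♯) · e X            ∎
    where open ≡-Reasoning

  isOrderedSaturation : IsOrderedSaturation (KlDataTS C T MT L MS) _≤_
  isOrderedSaturation = record
    { orderEnriched = record
        { isPartialOrder = λ X Y → isPartialOrder X (S₀ Y)
        ; ·-mono = λ g≤g' f≤f' → ·-mono ≤-refl (·-mono (S̄-mono g≤g') f≤f') }
    ; _* = star
    ; sat-1 = λ {X} α → ≤-resp-≡ (identityˡ (e X)) refl (·-mono (Sat.sat-1 (ext α)) ≤-refl)
    ; sat-2 = λ α → ≤-resp-≡ (ext-∘-η α) refl (·-mono (Sat.sat-2 (ext α)) ≤-refl)
    ; sat-3 = sat-3
    ; sat-4 = sat-4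
    ; sat-5≤ = λ f α β H → ≤-resp-≡ (sym (♯-•-star f α)) (sym (star-•-♯ f β))
        (·-mono (Sat.sat-5≤ (S₁ f) (ext α) (ext β)
          (≤-resp-≡ (sym (♯-ext f α)) (sym (ext-♯ β f))
            (ext-mono (≤-resp-≡ (♯-•ˡ f α) (♯-•ʳ β f) H)))) ≤-refl)
    ; sat-5≥ = λ f α β H → ≤-resp-≡ (sym (star-•-♯ f β)) (sym (♯-•-star f α))
        (·-mono (Sat.sat-5≥ (S₁ f) (ext α) (ext β)
          (≤-resp-≡ (sym (ext-♯ β f)) (sym (♯-ext f α))
            (ext-mono (≤-resp-≡ (♯-•ʳ β f) (♯-•ˡ f α) H)))) ≤-refl)
    }
    where
    sat-3 : ∀ {X} (α : KHom X (S₀ X)) → (m X · (S̄₁ (star α) · star α)) ≤ star α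
    sat-3 {X} α = let open ≤-Reasoning in begin
      m X · (S̄₁ (star α) · star α)   ≡⟨ •-ext (star α) (star α) ⟩
      ext (star α) · star α          ≡⟨ cong (_· star α) (ext-star α) ⟩
      ext α ⋆ · (ext α ⋆ · e X)      ≡⟨ assoc _ _ _ ⟨
      (ext α ⋆ · ext α ⋆) · e X      ≤⟨ ·-mono (Sat.sat-3 (ext α)) ≤-refl ⟩
      star α                         ∎

    sat-4 : ∀ {X} (α β : KHom X (S₀ X)) →
            e X ≤ β → α ≤ β → (m X · (S̄₁ β · β)) ≤ β → star α ≤ β
    sat-4 {X} α β e≤β α≤β β•β≤β = let open ≤-Reasoning in begin
      ext α ⋆ · e X   ≤⟨ ·-mono ext-α⋆≤ext-β ≤-refl ⟩
      ext β · e X     ≡⟨ ext-∘-η β ⟩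
      β               ∎
      where
      kid≤ext-β : kid ≤ ext β
      kid≤ext-β = ≤-resp-≡ ext-η refl (ext-mono e≤β)
      ext-β-transitive : (ext β · ext β) ≤ ext β
      ext-β-transitive =
        ≤-resp-≡ (ext-∘-ext β β) refl (ext-mono (≤-resp-≡ (•-ext β β) refl β•β≤β))
      ext-α⋆≤ext-β : (ext α ⋆) ≤ ext β
      ext-α⋆≤ext-β = Sat.sat-4 (ext α) (ext β) kid≤ext-β (ext-mono α≤β) ext-β-transitive

theorem5p10 : ∀ {o h ℓ : Level} (C : Category o h) (T : Functor C C) (MT : IsMonad C T)
    (_≤_ : ∀ {X Y} → Rel (KleisliOf.KHom C T MT X Y) ℓ)
    → IsOrderedSaturation (KlDataT C T MT) _≤_
    → (S : Functor C C) (L : Lifting C T MT S) (MS : IsMonad (KleisliOf.Kl C T MT) (liftedFunctor C T MT L))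
    → (W : IsωCpoEnriched (KleisliOf.Kl C T MT) _≤_)
    → (J : HasFiniteJoins (KleisliOf.Kl C T MT) _≤_)
    → (∀ {X Y} (c : ℕ → KleisliOf.KHom C T MT X Y) (p : IsChain (KleisliOf.Kl C T MT) _≤_ {X} {Y} c)
         → IsSup (KleisliOf.Kl C T MT) _≤_ (Lifting.S̄₁ L (IsωCpoEnriched.⋁ W c p))
                 (λ n → Lifting.S̄₁ L (c n)))
    → (∀ {X} (α : KleisliOf.KHom C T MT X (Functor.F₀ S X))
         → HasFiniteJoins._∨_ J (KleisliOf.kid C T MT)
             (KleisliOf._·_ C T MT (IsMonad.μ MS X) (Lifting.S̄₁ L α))
           ≡ KleisliOf._·_ C T MT (IsMonad.μ MS X)
               (Lifting.S̄₁ L (HasFiniteJoins._∨_ J (IsMonad.η MS X) α)))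
    → IsOrderedSaturation (KlDataTS C T MT L MS) _≤_
theorem5p10 C T MT _≤_ OS S L MS W J S̄-continuous join-ext =
  SaturationOfComposite.isOrderedSaturation C T MT _≤_ OS S L MS W J S̄-continuous join-ext
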